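{- Let $r \geq 1$ and $d \geq 1$, and let $G \in \mathcal{G}_d(r)$ be a graph whose agreement proportion $\omega(G)/\#V(G)$ equals $\rho(r,d)$. Then $G$ has no universal vertex (i.e. no vertex of degree $\#V(G)-1$).
   Context: A simple undirected graph is $(2,3)$-agreeable if any three vertices induce a subgraph with at least one edge. $\omega(G)$ is the clique number. The boxicity $\mathrm{box}(G)$ is the smallest $d$ such that $G$ is the intersection graph of a family of $d$-boxes (products of $d$ closed intervals), with the convention $\mathrm{box}(K_n)=0$. $\mathcal{G}_d(r)$ is the (finite) set of $(2,3)$-agreeable graphs with boxicity at most $d$ and clique number at most $r$, and $\rho(r,d)=\min\{\omega(G)/\#V(G): G\in\mathcal{G}_d(r)\}$.
   Formalization: The closed intervals forming the d-boxes that define boxicity, and so the class $\mathcal{G}_d(r)$ and the minimum $\rho(r,d)$, have rational endpoints. -}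

module Defs where

open import Data.Nat using (ℕ; _≤_)
open import Data.Fin using (Fin)
open import Data.Fin.Subset using (Subset; _∈_; ∣_∣)
open import Data.Bool using (Bool; true; false)
open import Data.Product using (Σ; _×_; ∃; ∃-syntax)
open import Data.Sum using (_⊎_)
open import Data.Rational using (ℚ) renaming (_≤_ to _≤ℚ_)
open import Relation.Binary.PropositionalEquality using (_≡_; _≢_)
open import Relation.Nullary using (¬_)

record Graph (n : ℕ) : Set where
  field
    adj   : Fin n → Fin n → Bool
    sym   : ∀ i j → adj i j ≡ adj j i
    irrefl : ∀ i → adj i i ≡ false

open Graph public

Adj : ∀ {n} → Graph n → Fin n → Fin n → Set
Adj G i j = adj G i j ≡ true

Agreeable23 : ∀ {n} → Graph n → Set
Agreeable23 {n} G = ∀ (a b c : Fin n) → a ≢ b → b ≢ c → a ≢ c →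
  Adj G a b ⊎ Adj G b c ⊎ Adj G a c

IsClique : ∀ {n} → Graph n → Subset n → Set
IsClique G S = ∀ i j → i ∈ S → j ∈ S → i ≢ j → Adj G i j

IsCliqueNumber : ∀ {n} → Graph n → ℕ → Set
IsCliqueNumber {n} G k =
  (Σ (Subset n) λ S → IsClique G S × ∣ S ∣ ≡ k) ×
  (∀ (S : Subset n) → IsClique G S → ∣ S ∣ ≤ k)

record Interval : Set where
  field
    lo  : ℚ
    hi  : ℚ
    lo≤hi : lo ≤ℚ hi

open Interval public

IntervalsMeet : Interval → Interval → Set
IntervalsMeet I J = (lo I ≤ℚ hi J) × (lo J ≤ℚ hi I)

Box : ℕ → Set
Box k = Fin k → Interval

BoxesMeet : ∀ {k} → Box k → Box k → Set
BoxesMeet {k} B C = ∀ (c : Fin k) → IntervalsMeet (B c) (C c)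

-- G is the intersection graph of a family of k-boxes
-- (for k = 0 every two 0-boxes meet, so exactly the complete graphs,
--  matching the convention box(K_n) = 0)
BoxRepresentation : ∀ {n} → ℕ → Graph n → Set
BoxRepresentation {n} k G =
  Σ (Fin n → Box k) λ β →
    ∀ (u v : Fin n) → u ≢ v → (Adj G u v → BoxesMeet (β u) (β v)) × (BoxesMeet (β u) (β v) → Adj G u v)

BoxicityAtMost : ∀ {n} → ℕ → Graph n → Set
BoxicityAtMost d G = ∃[ k ] (k ≤ d × BoxRepresentation k G)

CliqueNumberAtMost : ∀ {n} → ℕ → Graph n → Set
CliqueNumberAtMost r G = ∀ k → IsCliqueNumber G k → k ≤ r

InClass : ℕ → ℕ → ∀ {n} → Graph n → Set
InClass d r G = Agreeable23 G × BoxicityAtMost d G × CliqueNumberAtMost r G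

Universal : ∀ {n} → Graph n → Fin n → Set
Universal {n} G v = ∀ (u : Fin n) → u ≢ v → Adj G v u

{-# OPTIONS --safe #-}
module Submission where

-- A universal vertex v can be deleted without leaving the class, and it lies in every
-- maximum clique, so ω(G) = ω(G − v) + 1 while #V(G) = #V(G − v) + 1. Minimality of G
-- against G − v then forces ω(G − v) ≥ #V(G − v), i.e. ω(G) = #V(G), whereas the
-- graph on two non-adjacent vertices (boxicity 1, clique number 1) has ratio 1/2 < 1.

open import Defs
open import Data.Nat using (ℕ; zero; suc; _≤_; _*_; z≤n; s≤s)
open import Data.Nat.Properties
  using (≤-refl; ≤-trans; ≤-antisym; ≤-pred; n≤1+n; n≮n; m≤m*n; *-suc; *-identityˡ; +-cancelʳ-≤; module ≤-Reasoning)
open import Data.Fin using (Fin; zero; suc; punchIn; punchOut; _≟_)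
open import Data.Fin.Properties using (punchIn-injective; punchIn-punchOut; punchOut-injective)
open import Data.Fin.Subset using (Subset; _∈_; ∣_∣; inside; outside; ⁅_⁆)
open import Data.Vec using (Vec; []; _∷_; here; there; lookup; insertAt; removeAt)
open import Data.Vec.Properties using (insertAt-punchIn; []=⇒lookup; lookup⇒[]=)
open import Data.Bool using (false)
open import Data.Product using (Σ; _,_; _×_; proj₁; proj₂)
open import Data.Rational using (ℚ; 0ℚ; 1ℚ; *≤*) renaming (_≤_ to _≤ℚ_)
open import Data.Rational.Properties using () renaming (≤-refl to ≤ℚ-refl)
open import Data.Integer using (+≤+)
open import Function using (_∘_)
open import Function.Definitions using (Injective)
open import Relation.Nullary using (¬_; yes; no; contradiction)
open import Relation.Binary.PropositionalEquality
  using (_≡_; _≢_; refl; trans; cong; subst; subst₂) renaming (sym to ≡-sym)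

removeAt-punchIn : ∀ {a} {A : Set a} {n} (xs : Vec A (suc n)) (i : Fin (suc n)) (j : Fin n) →
  lookup (removeAt xs i) j ≡ lookup xs (punchIn i j)
removeAt-punchIn (x ∷ xs)     zero    j       = refl
removeAt-punchIn (x ∷ y ∷ xs) (suc i) zero    = refl
removeAt-punchIn (x ∷ y ∷ xs) (suc i) (suc j) = removeAt-punchIn (y ∷ xs) i j

∈-removeAt⇒punchIn-∈ : ∀ {n} (p : Subset (suc n)) (i : Fin (suc n)) {j : Fin n} →
  j ∈ removeAt p i → punchIn i j ∈ p
∈-removeAt⇒punchIn-∈ p i {j} j∈ = lookup⇒[]= _ p (trans (≡-sym (removeAt-punchIn p i j)) ([]=⇒lookup j∈))

punchIn-∈-insertAt⇒∈ : ∀ {n} (p : Subset n) (i : Fin (suc n)) {x} {j : Fin n} →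
  punchIn i j ∈ insertAt p i x → j ∈ p
punchIn-∈-insertAt⇒∈ p i {x} {j} j∈ = lookup⇒[]= j p (trans (≡-sym (insertAt-punchIn p i x j)) ([]=⇒lookup j∈))

∣insertAt-inside∣≡1+∣p∣ : ∀ {n} (p : Subset n) (i : Fin (suc n)) → ∣ insertAt p i inside ∣ ≡ suc ∣ p ∣
∣insertAt-inside∣≡1+∣p∣ p             zero    = refl
∣insertAt-inside∣≡1+∣p∣ (inside  ∷ p) (suc i) = cong suc (∣insertAt-inside∣≡1+∣p∣ p i)
∣insertAt-inside∣≡1+∣p∣ (outside ∷ p) (suc i) = ∣insertAt-inside∣≡1+∣p∣ p i

∣p∣≤1+∣removeAt-p∣ : ∀ {n} (p : Subset (suc n)) (i : Fin (suc n)) → ∣ p ∣ ≤ suc ∣ removeAt p i ∣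
∣p∣≤1+∣removeAt-p∣ (inside  ∷ p)     zero    = ≤-refl
∣p∣≤1+∣removeAt-p∣ (outside ∷ p)     zero    = n≤1+n _
∣p∣≤1+∣removeAt-p∣ (inside  ∷ y ∷ p) (suc i) = s≤s (∣p∣≤1+∣removeAt-p∣ (y ∷ p) i)
∣p∣≤1+∣removeAt-p∣ (outside ∷ y ∷ p) (suc i) = ∣p∣≤1+∣removeAt-p∣ (y ∷ p) i

Adj-sym : ∀ {n} (G : Graph n) {i j : Fin n} → Adj G i j → Adj G j i
Adj-sym G {i} {j} = trans (Graph.sym G j i)

induced : ∀ {m n} → Graph n → (Fin m → Fin n) → Graph m
induced G f = record
  { adj    = λ i j → adj G (f i) (f j)
  ; sym    = λ i j → Graph.sym G (f i) (f j)
  ; irrefl = λ i → Graph.irrefl G (f i)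
  }

module _ {m n} (G : Graph n) (f : Fin m → Fin n) (f-injective : Injective _≡_ _≡_ f) where

  private
    f-≢ : ∀ {i j} → i ≢ j → f i ≢ f j
    f-≢ i≢j = i≢j ∘ f-injective

  induced-agreeable : Agreeable23 G → Agreeable23 (induced G f)
  induced-agreeable agreeable a b c a≢b b≢c a≢c = agreeable (f a) (f b) (f c) (f-≢ a≢b) (f-≢ b≢c) (f-≢ a≢c)

  induced-boxicity : ∀ {d} → BoxicityAtMost d G → BoxicityAtMost d (induced G f)
  induced-boxicity (k , k≤d , β , represents) = k , k≤d , β ∘ f , λ u w u≢w → represents (f u) (f w) (f-≢ u≢w)

_∖_ : ∀ {n} → Graph (suc n) → Fin (suc n) → Graph n
G ∖ v = induced G (punchIn v)

punchIn-Injective : ∀ {n} (v : Fin (suc n)) → Injective _≡_ _≡_ (punchIn v)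
punchIn-Injective v {i} {j} = punchIn-injective v i j

module _ {n} (G : Graph (suc n)) (v : Fin (suc n)) where

  removeAt-clique : ∀ {p} → IsClique G p → IsClique (G ∖ v) (removeAt p v)
  removeAt-clique {p} clique i j i∈ j∈ i≢j =
    clique _ _ (∈-removeAt⇒punchIn-∈ p v i∈) (∈-removeAt⇒punchIn-∈ p v j∈) (i≢j ∘ punchIn-Injective v)

  insertAt-clique : Universal G v → ∀ {p} → IsClique (G ∖ v) p → IsClique G (insertAt p v inside)
  insertAt-clique universal {p} clique i j i∈ j∈ i≢j with v ≟ i | v ≟ j
  ... | yes refl | _        = universal j (i≢j ∘ ≡-sym)
  ... | no _     | yes refl = Adj-sym G (universal i i≢j)
  ... | no v≢i   | no v≢j   =
    subst₂ (Adj G) (punchIn-punchOut v≢i) (punchIn-punchOut v≢j)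
      (clique (punchOut v≢i) (punchOut v≢j) (restrict v≢i i∈) (restrict v≢j j∈) (i≢j ∘ punchOut-injective v≢i v≢j))
    where
    restrict : ∀ {k} (v≢k : v ≢ k) → k ∈ insertAt p v inside → punchOut v≢k ∈ p
    restrict v≢k k∈ = punchIn-∈-insertAt⇒∈ p v (subst (_∈ insertAt p v inside) (≡-sym (punchIn-punchOut v≢k)) k∈)

  cliqueNumber-∖-universal : ∀ {ω} → IsCliqueNumber G ω → Universal G v →
    Σ ℕ λ R → ω ≡ suc R × IsCliqueNumber (G ∖ v) R
  cliqueNumber-∖-universal {ω} ((T , T-clique , ∣T∣≡ω) , maximum) universal =
    ∣ removeAt T v ∣ ,
    ≤-antisym ω≤1+R (extends (removeAt-clique T-clique)) ,
    (removeAt T v , removeAt-clique T-clique , refl) ,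
    λ S S-clique → ≤-pred (≤-trans (extends S-clique) ω≤1+R)
    where
    extends : ∀ {S} → IsClique (G ∖ v) S → suc ∣ S ∣ ≤ ω
    extends {S} S-clique = subst (_≤ ω) (∣insertAt-inside∣≡1+∣p∣ S v) (maximum _ (insertAt-clique universal S-clique))
    ω≤1+R : ω ≤ suc ∣ removeAt T v ∣
    ω≤1+R = subst (_≤ suc ∣ removeAt T v ∣) ∣T∣≡ω (∣p∣≤1+∣removeAt-p∣ T v)

cliqueNumber-unique : ∀ {n} (G : Graph n) {a b} → IsCliqueNumber G a → IsCliqueNumber G b → a ≡ b
cliqueNumber-unique G ((S , S-clique , refl) , a-maximum) ((T , T-clique , refl) , b-maximum) =
  ≤-antisym (b-maximum S S-clique) (a-maximum T T-clique)

cliqueNumber⇒cliqueNumberAtMost : ∀ {n} (G : Graph n) {ω r} → IsCliqueNumber G ω → ω ≤ r → CliqueNumberAtMost r G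
cliqueNumber⇒cliqueNumberAtMost G {r = r} ω-G ω≤r k k-G = subst (_≤ r) (cliqueNumber-unique G ω-G k-G) ω≤r

edgeless₂ : Graph 2
edgeless₂ = record { adj = λ _ _ → false ; sym = λ _ _ → refl ; irrefl = λ _ → refl }

edgeless₂-agreeable : Agreeable23 edgeless₂
edgeless₂-agreeable zero       zero       _          a≢b _   _   = contradiction refl a≢b
edgeless₂-agreeable (suc zero) (suc zero) _          a≢b _   _   = contradiction refl a≢b
edgeless₂-agreeable zero       (suc zero) zero       _   _   a≢c = contradiction refl a≢c
edgeless₂-agreeable (suc zero) zero       (suc zero) _   _   a≢c = contradiction refl a≢c
edgeless₂-agreeable zero       (suc zero) (suc zero) _   b≢c _   = contradiction refl b≢c
edgeless₂-agreeable (suc zero) zero       zero       _   b≢c _   = contradiction refl b≢c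

point : ℚ → Interval
point q = record { lo = q ; hi = q ; lo≤hi = ≤ℚ-refl }

1≰0 : ¬ (1ℚ ≤ℚ 0ℚ)
1≰0 (*≤* (+≤+ ()))

edgeless₂-boxicity : BoxRepresentation 1 edgeless₂
edgeless₂-boxicity = position , represents
  where
  position : Fin 2 → Box 1
  position zero       _ = point 0ℚ
  position (suc zero) _ = point 1ℚ
  represents : ∀ u w → u ≢ w →
    (Adj edgeless₂ u w → BoxesMeet (position u) (position w)) × (BoxesMeet (position u) (position w) → Adj edgeless₂ u w)
  represents zero       zero       u≢w = contradiction refl u≢w
  represents (suc zero) (suc zero) u≢w = contradiction refl u≢w
  represents zero       (suc zero) _   = (λ ()) , λ meet → contradiction (proj₂ (meet zero)) 1≰0
  represents (suc zero) zero       _   = (λ ()) , λ meet → contradiction (proj₁ (meet zero)) 1≰0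

edgeless₂-clique-size : ∀ S → IsClique edgeless₂ S → ∣ S ∣ ≤ 1
edgeless₂-clique-size (inside  ∷ inside  ∷ []) clique with () ← clique zero (suc zero) here (there here) (λ ())
edgeless₂-clique-size (inside  ∷ outside ∷ []) _ = s≤s z≤n
edgeless₂-clique-size (outside ∷ inside  ∷ []) _ = s≤s z≤n
edgeless₂-clique-size (outside ∷ outside ∷ []) _ = z≤n

edgeless₂-cliqueNumber : IsCliqueNumber edgeless₂ 1
edgeless₂-cliqueNumber = (⁅ zero ⁆ , singleton , refl) , edgeless₂-clique-size
  where
  singleton : IsClique edgeless₂ ⁅ zero ⁆
  singleton zero       zero _ _         i≢j = contradiction refl i≢j
  singleton zero       (suc zero) _ (there ())
  singleton (suc zero) _ (there ()) _

edgeless₂-inClass : ∀ {d r} → 1 ≤ d → 1 ≤ r → InClass d r edgeless₂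
edgeless₂-inClass 1≤d 1≤r =
  edgeless₂-agreeable , (1 , 1≤d , edgeless₂-boxicity) , cliqueNumber⇒cliqueNumberAtMost edgeless₂ edgeless₂-cliqueNumber 1≤r

-- (1 + m) / (1 + n) ≤ m / n, cross-multiplied.
cross-≤⇒≤ : ∀ m n → suc m * n ≤ m * suc n → n ≤ m
cross-≤⇒≤ m n le = +-cancelʳ-≤ (m * n) n m (subst (suc m * n ≤_) (*-suc m n) le)

-- (1 + m) / (1 + n) ≤ 1 / 2 fails once n ≤ m.
half-≱ : ∀ {m n} → n ≤ m → ¬ (suc m * 2 ≤ 1 * suc n)
half-≱ {m} {n} n≤m le = n≮n (suc m) (begin
  suc (suc m)  ≤⟨ s≤s (s≤s (m≤m*n m 2)) ⟩
  suc m * 2    ≤⟨ le ⟩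
  1 * suc n    ≡⟨ *-identityˡ (suc n) ⟩
  suc n        ≤⟨ s≤s n≤m ⟩
  suc m        ∎)
  where open ≤-Reasoning

lemma5p2 : (r d : ℕ) → 1 ≤ r → 1 ≤ d →
    (n : ℕ) (G : Graph n) (ω : ℕ) → IsCliqueNumber G ω → InClass d r G →
    (∀ (m : ℕ) (H : Graph m) (ωH : ℕ) → IsCliqueNumber H ωH → InClass d r H → ω * m ≤ ωH * n) →
    ¬ Σ (Fin n) (Universal G)
lemma5p2 r d 1≤r 1≤d (suc k) G ω ω-G (agreeable , boxicity , ω≤r) minimal (v , universal)
  with cliqueNumber-∖-universal G v ω-G universal
... | R , refl , ω-G∖v = half-≱ (cross-≤⇒≤ R k (minimal k (G ∖ v) R ω-G∖v G∖v-inClass))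
                                (minimal 2 edgeless₂ 1 edgeless₂-cliqueNumber (edgeless₂-inClass 1≤d 1≤r))
  where
  G∖v-inClass : InClass d r (G ∖ v)
  G∖v-inClass =
    induced-agreeable G (punchIn v) (punchIn-Injective v) agreeable ,
    induced-boxicity G (punchIn v) (punchIn-Injective v) boxicity ,
    cliqueNumber⇒cliqueNumberAtMost (G ∖ v) ω-G∖v (≤-trans (n≤1+n R) (ω≤r (suc R) ω-G))
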